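{- Fix $0<\alpha<1$. Let $G$ be a graph without isolated vertices, $B$ a $\wedge_{d,\alpha}$-FBDD representing $\varphi(G)$, $P$ a mainstream path of $B$, and $U_0,U_1\subseteq V(G)\setminus Var(P)$ such that $(Var(P),U_0,U_1)$ is a target triple. For each $u\in U_0$ let $I_u=N(u)\cap Var(P)$ if $\mathbf a(P)$ assigns $1$ to every vertex of $N(u)\cap Var(P)$, and $I_u=\{u\}$ otherwise; let $I(P,U_0,U_1)=\bigcup_{u\in U_0}I_u$. Then $I(P,U_0,U_1)$ is an independent set of $G$.
   Context: $\varphi(G)$ is the CNF over $V(G)$ with clauses $(u\vee v)$ for $\{u,v\}\in E(G)$. A $\wedge_d$-FBDD is a DAG with one source, at most two sinks ($True$/$False$), non-sink nodes with two children labelled by a variable (out-edges labelled $0$,$1$) or by $\wedge$, read-once (no directed path repeats a variable) and decomposable (children $u_1,u_2$ of a $\wedge$-node have disjoint $Var(B_{u_1}),Var(B_{u_2})$, $B_u$ being the sub-DAG reachable from $u$). Semantics: $\mathcal S(B)=\{\emptyset\}$/$\emptyset$ at $True$/$False$ sinks; at a variable source $x$ with $0$-child $u_0$, $1$-child $u_1$: $\{(x,0)\}\times\mathcal S(B_{u_0})\times\{0,1\}^{Var(B_{u_1})\setminus Var(B_{u_0})}\cup\{(x,1)\}\times\mathcal S(B_{u_1})\times\{0,1\}^{Var(B_{u_0})\setminus Var(B_{u_1})}$; at a $\wedge$ source: $\mathcal S(B_{u_0})\times\mathcal S(B_{u_1})$. With $n=|Var(B)|$, $u$ small iff $|Var(B_u)|\le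 n^\alpha$; $\wedge_{d,\alpha}$-FBDD: every $\wedge$-node has a small child. Target path $P$: directed path from the source; $u(P)$ last node; $Var(P)$ variables labelling nodes of $P$ other than $u(P)$; $\mathbf a(P)$ maps each such $x$ to the label of the $P$-edge leaving its node. $P$ is mainstream if for every $\wedge$-node of $P$ other than $u(P)$ its child not on $P$ is small. Target triple in $G$ ($n=|V(G)|$): disjoint $W,U_0,U_1$ with (1) components of $G[U_1]$ of size $>n^\alpha$; (2) each $U_0$-vertex adjacent to $U_1$ and $W$; (3) $U_1$ not adjacent to $W$; (4) $U_0$ independent; (5) $N(U_0)\cap W$ independent; (6) $N(u_1)\cap W\cap N(u_2)=\emptyset$ for distinct $u_1,u_2\in U_0$. -}

module Defs where

open import Data.Nat using (ℕ; zero; suc; _+_; _*_; _^_; _≤_; _<_)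
open import Data.Bool using (Bool; true; false)
open import Data.Fin using (Fin)
open import Data.Fin.Subset using (Subset; ⁅_⁆; _∪_; _∈_; _∉_; ∣_∣)
open import Data.List using (List; length)
open import Data.List.Relation.Unary.All using (All)
open import Data.List.Relation.Unary.Unique.Propositional using (Unique)
open import Data.Product using (Σ; ∃; _×_; _,_)
open import Data.Sum using (_⊎_)
open import Data.Unit using (⊤)
open import Data.Empty using (⊥)
open import Relation.Nullary using (¬_)
open import Relation.Binary.PropositionalEquality using (_≡_; _≢_)
open import Function.Bundles using (_⇔_)

-- The real exponent α with 0 < α < 1, given by its strict upper
-- Dedekind cut: Above p q  means  q > 0 and α < p / q.

record Exponent : Set₁ where
  field
    Above      : ℕ → ℕ → Set
    den-pos    : ∀ {p q} → Above p q → 0 < q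
    up-closed  : ∀ {p q p′ q′} → Above p q → 0 < q′ → p * q′ ≤ p′ * q → Above p′ q′
    rounded    : ∀ {p q} → Above p q → Σ ℕ λ p′ → Σ ℕ λ q′ → Above p′ q′ × p′ * q < p * q′
    positive   : Σ ℕ λ p → Σ ℕ λ q → 0 < p × 0 < q × ¬ Above p q
    below-one  : Σ ℕ λ p → Σ ℕ λ q → p < q × Above p q

-- k ≤ N^α  (for naturals k, N)
LeqPow : Exponent → ℕ → ℕ → Set
LeqPow α k N = ∀ p q → Exponent.Above α p q → k ^ q ≤ N ^ p

record Graph (n : ℕ) : Set where
  field
    adj    : Fin n → Fin n → Bool
    sym    : ∀ u v → adj u v ≡ adj v u
    irrefl : ∀ u → adj u u ≡ false

module _ {n : ℕ} (G : Graph n) where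
  Adj : Fin n → Fin n → Set
  Adj u v = Graph.adj G u v ≡ true

  NoIsolated : Set
  NoIsolated = ∀ v → ∃ λ u → Adj v u

  Independent : (Fin n → Set) → Set
  Independent I = ∀ x y → I x → I y → ¬ Adj x y

  PhiG : (Fin n → Bool) → Set
  PhiG σ = ∀ u v → Adj u v → (σ u ≡ true) ⊎ (σ v ≡ true)

  data Conn (U : Fin n → Set) (v : Fin n) : Fin n → Set where
    here : Conn U v v
    step : ∀ {w w′} → Conn U v w → Adj w w′ → U w′ → Conn U v w′

-- ∧_d-FBDDs (tree unfolding of the DAG)

data FBDD (n : ℕ) : Set where
  trueSink  : FBDD n
  falseSink : FBDD n
  dec       : Fin n → FBDD n → FBDD n → FBDD n   -- variable, 0-child, 1-child
  conj      : FBDD n → FBDD n → FBDD n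

module _ {n : ℕ} where
  vars : FBDD n → Subset n
  vars trueSink = Data.Fin.Subset.⊥
  vars falseSink = Data.Fin.Subset.⊥
  vars (dec x l r) = ⁅ x ⁆ ∪ (vars l ∪ vars r)
  vars (conj l r) = vars l ∪ vars r

  IsFBDD : FBDD n → Set
  IsFBDD trueSink = ⊤
  IsFBDD falseSink = ⊤
  IsFBDD (dec x l r) = x ∉ vars l × x ∉ vars r × IsFBDD l × IsFBDD r
  IsFBDD (conj l r) = (∀ x → x ∈ vars l → x ∉ vars r) × IsFBDD l × IsFBDD r

  Small : Exponent → ℕ → FBDD n → Set
  Small α N u = LeqPow α ∣ vars u ∣ N

  -- every ∧-node has a small child (N = |Var(B)| of the whole diagram)
  AllAndSmall : Exponent → ℕ → FBDD n → Set
  AllAndSmall α N trueSink = ⊤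
  AllAndSmall α N falseSink = ⊤
  AllAndSmall α N (dec x l r) = AllAndSmall α N l × AllAndSmall α N r
  AllAndSmall α N (conj l r) = (Small α N l ⊎ Small α N r) × AllAndSmall α N l × AllAndSmall α N r

  IsAndAlphaFBDD : Exponent → FBDD n → Set
  IsAndAlphaFBDD α B = IsFBDD B × AllAndSmall α ∣ vars B ∣ B

  -- semantics at a total assignment σ (σ restricted to Var(B) ∈ S(B))
  Sat : FBDD n → (Fin n → Bool) → Set
  Sat trueSink σ = ⊤
  Sat falseSink σ = ⊥
  Sat (dec x l r) σ with σ x
  ... | false = Sat l σ
  ... | true  = Sat r σ
  Sat (conj l r) σ = Sat l σ × Sat r σ

  Represents : FBDD n → Graph n → Set
  Represents B G = (∀ x → x ∈ vars B) × (∀ σ → Sat B σ ⇔ PhiG G σ)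

  data Path : FBDD n → Set where
    stop : ∀ {B} → Path B
    go0  : ∀ {x l r} → Path l → Path (dec x l r)
    go1  : ∀ {x l r} → Path r → Path (dec x l r)
    goL  : ∀ {l r} → Path l → Path (conj l r)
    goR  : ∀ {l r} → Path r → Path (conj l r)

  -- Assigns P x b :  x ∈ Var(P) and a(P)(x) = b
  data Assigns : {B : FBDD n} → Path B → Fin n → Bool → Set where
    a0   : ∀ {x l r} {p : Path l} → Assigns (go0 {x} {l} {r} p) x false
    a1   : ∀ {x l r} {p : Path r} → Assigns (go1 {x} {l} {r} p) x true
    in0  : ∀ {x l r y b} {p : Path l} → Assigns p y b → Assigns (go0 {x} {l} {r} p) y b
    in1  : ∀ {x l r y b} {p : Path r} → Assigns p y b → Assigns (go1 {x} {l} {r} p) y b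
    inL  : ∀ {l r y b} {p : Path l} → Assigns p y b → Assigns (goL {l} {r} p) y b
    inR  : ∀ {l r y b} {p : Path r} → Assigns p y b → Assigns (goR {l} {r} p) y b

  VarP : {B : FBDD n} → Path B → Fin n → Set
  VarP P x = ∃ λ b → Assigns P x b

  Mainstream : Exponent → ℕ → {B : FBDD n} → Path B → Set
  Mainstream α N stop = ⊤
  Mainstream α N (go0 p) = Mainstream α N p
  Mainstream α N (go1 p) = Mainstream α N p
  Mainstream α N (goL {r = r} p) = Small α N r × Mainstream α N p
  Mainstream α N (goR {l = l} p) = Small α N l × Mainstream α N p

module _ {n : ℕ} (α : Exponent) (G : Graph n) where
  TargetTriple : (W U₀ U₁ : Fin n → Set) → Set
  TargetTriple W U₀ U₁ =
      (∀ x → W x → ¬ U₀ x) × (∀ x → W x → ¬ U₁ x) × (∀ x → U₀ x → ¬ U₁ x)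
    -- (1) every component of G[U₁] has more than n^α vertices
    × (∀ v → U₁ v → Σ (List (Fin n)) λ xs →
          Unique xs × All (Conn G U₁ v) xs × ¬ LeqPow α (length xs) n)
    × (∀ u → U₀ u → (∃ λ v → U₁ v × Adj G u v) × (∃ λ w → W w × Adj G u w))
    × (∀ u w → U₁ u → W w → ¬ Adj G u w)
    × Independent G U₀
    × Independent G (λ w → W w × ∃ λ u → U₀ u × Adj G u w)
    × (∀ u₁ u₂ w → U₀ u₁ → U₀ u₂ → u₁ ≢ u₂ → W w → Adj G u₁ w → ¬ Adj G u₂ w)

  module _ {B : FBDD n} (P : Path B) where
    AllOnes : Fin n → Set
    AllOnes u = ∀ w → Adj G u w → VarP P w → Assigns P w true

    Iu : Fin n → Fin n → Set
    Iu u x = (AllOnes u × Adj G u x × VarP P x) ⊎ (¬ AllOnes u × x ≡ u)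

    ISet : (U₀ : Fin n → Set) → Fin n → Set
    ISet U₀ x = ∃ λ u → U₀ u × Iu u x

{-# OPTIONS --safe #-}
module Submission where

open import Defs
open import Data.Nat using (ℕ)
open import Data.Fin using (Fin; _≟_)
open import Data.Product using (∃; _×_; _,_)
open import Data.Sum using (_⊎_; inj₁; inj₂)
open import Relation.Nullary using (¬_; yes; no)
open import Relation.Binary.PropositionalEquality using (_≡_; _≢_; refl; trans)

-- The claim is purely combinatorial: I(P,U₀,U₁) is independent by conditions
-- (4)–(6) of the target triple alone. Two vertices of the form u, v ∈ U₀ are
-- non-adjacent by (4), two vertices of N(U₀) ∩ W by (5), and a neighbour
-- x ∈ W of u cannot be adjacent to another v ∈ U₀ by (6); when v = u the two
-- cases defining I_u exclude each other.

module _ {n : ℕ} (G : Graph n) where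

  Adj-sym : ∀ {x y} → Adj G x y → Adj G y x
  Adj-sym {x} {y} = trans (Graph.sym G y x)

  -- The union of I_u over u ∈ U₀, with "a(P) assigns 1 to N(u) ∩ W" abstracted to Good u.
  Selection : (W Good U₀ : Fin n → Set) → Fin n → Set
  Selection W Good U₀ x = ∃ λ u → U₀ u × ((Good u × Adj G u x × W x) ⊎ (¬ Good u × x ≡ u))

  module _ {W U₀ : Fin n → Set}
           (U₀-private : ∀ u₁ u₂ w → U₀ u₁ → U₀ u₂ → u₁ ≢ u₂ → W w →
                         Adj G u₁ w → ¬ Adj G u₂ w)
           where

    good-neighbour-≁-bad : ∀ {Good : Fin n → Set} {u v x} → U₀ u → U₀ v →
                           Good u → Adj G u x → W x → ¬ Good v → ¬ Adj G x v
    good-neighbour-≁-bad {u = u} {v} U₀u U₀v good-u u~x Wx bad-v x~v with u ≟ v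
    ... | yes refl = bad-v good-u
    ... | no u≢v   = U₀-private u v _ U₀u U₀v u≢v Wx u~x (Adj-sym x~v)

    Selection-independent : ∀ {Good : Fin n → Set} →
                            Independent G U₀ →
                            Independent G (λ w → W w × ∃ λ u → U₀ u × Adj G u w) →
                            Independent G (Selection W Good U₀)
    Selection-independent _ N-indep x y (u , U₀u , inj₁ (_ , u~x , Wx)) (v , U₀v , inj₁ (_ , v~y , Wy)) =
      N-indep x y (Wx , u , U₀u , u~x) (Wy , v , U₀v , v~y)
    Selection-independent _ _ x y (u , U₀u , inj₁ (good-u , u~x , Wx)) (v , U₀v , inj₂ (bad-v , refl)) =
      good-neighbour-≁-bad U₀u U₀v good-u u~x Wx bad-v
    Selection-independent _ _ x y (u , U₀u , inj₂ (bad-u , refl)) (v , U₀v , inj₁ (good-v , v~y , Wy)) x~y =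
      good-neighbour-≁-bad U₀v U₀u good-v v~y Wy bad-u (Adj-sym x~y)
    Selection-independent U₀-indep _ x y (u , U₀u , inj₂ (_ , refl)) (v , U₀v , inj₂ (_ , refl)) =
      U₀-indep u v U₀u U₀v

lemma7 : (α : Exponent) (n : ℕ) (G : Graph n) → NoIsolated G →
         (B : FBDD n) → IsAndAlphaFBDD α B → Represents B G →
         (P : Path B) → Mainstream α n P →
         (U₀ U₁ : Fin n → Set) →
         (∀ x → U₀ x → ¬ VarP P x) → (∀ x → U₁ x → ¬ VarP P x) →
         TargetTriple α G (VarP P) U₀ U₁ →
         Independent G (ISet α G P U₀)
lemma7 α n G _ B _ _ P _ U₀ U₁ _ _ (_ , _ , _ , _ , _ , _ , U₀-indep , N-indep , U₀-private) =
  Selection-independent G U₀-private U₀-indep N-indep
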